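{- Let $d$ and $n$ be positive integers with $n \geq d+1$, let $\tau_1 < \cdots < \tau_n$ be integers, and put $\Delta_{ij} = \tau_j - \tau_i$. Let $V$ be the $n \times (d+1)$ integer matrix whose $i$-th row is $v_i = (1, \tau_i, \tau_i^2, \ldots, \tau_i^d)$, and let $W$ be the $n \times (d+1)$ integer matrix whose entry in row $i$ and column $k$ (columns indexed $k = 0, 1, \ldots, d$) is $\prod_{m=1}^{k} \Delta_{m i}$ (the empty product being $1$; note this is $0$ whenever $k \geq i$). Then there is a matrix $U \in GL_{d+1}(\mathbb{Z})$ with $VU = W$. In particular, the convex hull of the rows of $W$ is unimodularly equivalent to the convex hull of $v_1, \ldots, v_n$.
   Context: Two subsets of $\mathbb{R}^{d+1}$ are unimodularly equivalent if one is the image of the other under a linear map given by a matrix in $GL_{d+1}(\mathbb{Z})$ (acting on row vectors by right multiplication). -}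

module Defs where

open import Data.Nat as ℕ using (ℕ; zero; suc)
open import Data.Fin as Fin using (Fin; toℕ; _≟_)
open import Data.Integer using (ℤ; _+_; _-_; _*_; _^_; 0ℤ; 1ℤ)
open import Data.Bool using (if_then_else_)
open import Data.Product using (Σ; _×_)
open import Relation.Nullary.Decidable using (does)
open import Relation.Binary.PropositionalEquality using (_≡_)
import Data.Vec.Functional as VF

Matrix : ℕ → ℕ → Set
Matrix m k = Fin m → Fin k → ℤ

sumFin : ∀ {n} → (Fin n → ℤ) → ℤ
sumFin f = VF.foldr _+_ 0ℤ f

prodFin : ∀ {n} → (Fin n → ℤ) → ℤ
prodFin f = VF.foldr _*_ 1ℤ f

mul : ∀ {m k l} → Matrix m k → Matrix k l → Matrix m l
mul A B i j = sumFin (λ r → A i r * B r j)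

idMat : ∀ {k} → Matrix k k
idMat i j = if does (i ≟ j) then 1ℤ else 0ℤ

InGL : ∀ {k} → Matrix k k → Set
InGL {k} U = Σ (Matrix k k) (λ U' →
  (∀ i j → mul U U' i j ≡ idMat i j) × (∀ i j → mul U' U i j ≡ idMat i j))

-- Rows are indexed 0..n-1 (paper: 1..n), columns 0..d.
-- V i k = τ_i ^ k
vandermonde : ∀ {n} d → (Fin n → ℤ) → Matrix n (suc d)
vandermonde d τ i k = τ i ^ toℕ k

-- W i k = ∏_{m=1}^{k} Δ_{m i} = ∏_{m=1}^{k} (τ_i - τ_m), paper indexing.
-- 0-indexed: product over row indices m with toℕ m < toℕ k of (τ i - τ m).
Wmat : ∀ {n} d → (Fin n → ℤ) → Matrix n (suc d)
Wmat d τ i k = prodFin (λ m → if does (toℕ m ℕ.<? toℕ k) then τ i - τ m else 1ℤ)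

-- U is the change of basis from the monomials 1, x, …, x^d to the Newton basis
-- p_k(x) = ∏_{m<k} (x − τ_m): column k of U lists the coefficients of p_k, so
-- (V U)_{ik} = p_k(τ_i) = W_{ik}. Each p_k is monic of degree k, so U is upper
-- unitriangular, and such matrices are invertible over ℤ by block elimination.
module Submission where

open import Defs
open import Data.Nat using (ℕ; suc; _≤_)
open import Data.Fin using (Fin)
open import Data.Integer using (ℤ)
open import Data.Product using (Σ; _×_)
open import Relation.Binary.PropositionalEquality using (_≡_)
import Data.Fin as F
import Data.Integer as Z

open import Data.Nat as ℕ using (zero; _<_; _<?_; s≤s)
open import Data.Nat.Properties using (n<1+n; m<n⇒m<1+n; ≤-trans; <⇒≤)
open import Data.Fin using (toℕ; inject₁; fromℕ)
open import Data.Fin.Properties using (toℕ<n; toℕ-inject₁; toℕ-fromℕ)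
open import Data.Integer using (_+_; _-_; _*_; -_; _^_; 0ℤ; 1ℤ; -1ℤ)
import Data.Integer.Properties as ℤ
open import Data.Integer.Solver using (module +-*-Solver)
open import Data.Product using (_,_)
open import Data.Bool using (if_then_else_)
open import Function using (_∘_)
open import Relation.Nullary.Decidable using (does)
open import Relation.Binary.PropositionalEquality
  using (refl; sym; trans; cong; cong₂; _≗_; module ≡-Reasoning)
open import Algebra.Properties.Semiring.Sum ℤ.+-*-semiring
  using (sum-cong-≗; sum-replicate-zero; sum-init-last; ∑-distrib-+; ∑-comm;
         *-distribˡ-sum; *-distribʳ-sum)

open +-*-Solver
open ≡-Reasoning

sum-zero : ∀ {n} {f : Fin n → ℤ} → (∀ i → f i ≡ 0ℤ) → sumFin f ≡ 0ℤ
sum-zero {n} f≗0 = trans (sum-cong-≗ f≗0) (sum-replicate-zero n)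

prod-one : ∀ {n} {f : Fin n → ℤ} → (∀ i → f i ≡ 1ℤ) → prodFin f ≡ 1ℤ
prod-one {zero}  f≗1 = refl
prod-one {suc n} f≗1 = cong₂ _*_ (f≗1 F.zero) (prod-one (f≗1 ∘ F.suc))

sum-neg : ∀ {n} (f : Fin n → ℤ) → sumFin (λ i → - f i) ≡ - sumFin f
sum-neg f = begin
  sumFin (λ i → - f i)       ≡⟨ sum-cong-≗ (λ i → sym (ℤ.-1*i≡-i (f i))) ⟩
  sumFin (λ i → -1ℤ * f i)   ≡⟨ sym (*-distribˡ-sum -1ℤ f) ⟩
  -1ℤ * sumFin f             ≡⟨ ℤ.-1*i≡-i (sumFin f) ⟩
  - sumFin f                 ∎

sum-distrib-- : ∀ {n} (f g : Fin n → ℤ) → sumFin (λ i → f i - g i) ≡ sumFin f - sumFin g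
sum-distrib-- f g = trans (∑-distrib-+ f (λ i → - g i)) (cong (sumFin f +_) (sum-neg g))

infixl 7 _ᵥ*_

_ᵥ*_ : ∀ {k l} → (Fin k → ℤ) → Matrix k l → (Fin l → ℤ)
(a ᵥ* B) j = sumFin (λ r → a r * B r j)

ᵥ*-assoc : ∀ {k l p} (a : Fin k → ℤ) (B : Matrix k l) (C : Matrix l p) →
           (a ᵥ* B) ᵥ* C ≗ a ᵥ* mul B C
ᵥ*-assoc a B C j = begin
  sumFin (λ r → sumFin (λ s → a s * B s r) * C r j)
    ≡⟨ sum-cong-≗ (λ r → *-distribʳ-sum (C r j) (λ s → a s * B s r)) ⟩
  sumFin (λ r → sumFin (λ s → a s * B s r * C r j))
    ≡⟨ ∑-comm (λ r s → a s * B s r * C r j) ⟩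
  sumFin (λ s → sumFin (λ r → a s * B s r * C r j))
    ≡⟨ sum-cong-≗ (λ s → sum-cong-≗ (λ r → ℤ.*-assoc (a s) (B s r) (C r j))) ⟩
  sumFin (λ s → sumFin (λ r → a s * (B s r * C r j)))
    ≡⟨ sum-cong-≗ (λ s → sym (*-distribˡ-sum (a s) (λ r → B s r * C r j))) ⟩
  sumFin (λ s → a s * sumFin (λ r → B s r * C r j)) ∎

ᵥ*-identityʳ : ∀ {k} (a : Fin k → ℤ) → a ᵥ* idMat ≗ a
ᵥ*-identityʳ {suc k} a F.zero = begin
  a F.zero * 1ℤ + sumFin (λ r → a (F.suc r) * 0ℤ)
    ≡⟨ cong₂ _+_ (ℤ.*-identityʳ (a F.zero)) (sum-zero (λ r → ℤ.*-zeroʳ (a (F.suc r)))) ⟩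
  a F.zero + 0ℤ
    ≡⟨ ℤ.+-identityʳ (a F.zero) ⟩
  a F.zero ∎
ᵥ*-identityʳ {suc k} a (F.suc j) = begin
  a F.zero * 0ℤ + ((a ∘ F.suc) ᵥ* idMat) j
    ≡⟨ cong₂ _+_ (ℤ.*-zeroʳ (a F.zero)) (ᵥ*-identityʳ (a ∘ F.suc) j) ⟩
  0ℤ + a (F.suc j)
    ≡⟨ ℤ.+-identityˡ (a (F.suc j)) ⟩
  a (F.suc j) ∎

ᵥ*-negˡ : ∀ {k l} (a : Fin k → ℤ) (B : Matrix k l) → (λ r → - a r) ᵥ* B ≗ -_ ∘ (a ᵥ* B)
ᵥ*-negˡ a B j = trans (sum-cong-≗ (λ r → sym (ℤ.neg-distribˡ-* (a r) (B r j))))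
                      (sum-neg (λ r → a r * B r j))

ᵥ*-zero-column : ∀ {k l} (a : Fin k → ℤ) (B : Matrix k l) j →
                 (∀ r → B r j ≡ 0ℤ) → (a ᵥ* B) j ≡ 0ℤ
ᵥ*-zero-column a B j Bj≡0 = sum-zero (λ r → trans (cong (a r *_) (Bj≡0 r)) (ℤ.*-zeroʳ (a r)))

record IsUpperUnitriangular {k} (A : Matrix k k) : Set where
  field
    below-diagonal : ∀ i j → toℕ j < toℕ i → A i j ≡ 0ℤ
    diagonal       : ∀ i → A i i ≡ 1ℤ

topRow : ∀ {k} → Matrix (suc k) (suc k) → (Fin k → ℤ)
topRow A j = A F.zero (F.suc j)

minor : ∀ {k} → Matrix (suc k) (suc k) → Matrix k k
minor A i j = A (F.suc i) (F.suc j)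

minor-unitriangular : ∀ {k} {A : Matrix (suc k) (suc k)} →
                      IsUpperUnitriangular A → IsUpperUnitriangular (minor A)
minor-unitriangular ut = record
  { below-diagonal = λ i j j<i → below-diagonal (F.suc i) (F.suc j) (s≤s j<i)
  ; diagonal       = diagonal ∘ F.suc
  }
  where open IsUpperUnitriangular ut

unitriangular-first-column : ∀ {k} {A : Matrix (suc k) (suc k)} →
                             IsUpperUnitriangular A → ∀ m → A (F.suc m) F.zero ≡ 0ℤ
unitriangular-first-column ut m =
  IsUpperUnitriangular.below-diagonal ut (F.suc m) F.zero (s≤s ℕ.z≤n)

-- Block inversion along the first row: [[1 , a] , [0 , A']]⁻¹ = [[1 , - a A'⁻¹] , [0 , A'⁻¹]].
unitriangularInverse : ∀ {k} → Matrix k k → Matrix k k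
unitriangularInverse {suc k} A F.zero    F.zero    = 1ℤ
unitriangularInverse {suc k} A F.zero    (F.suc j) = - (topRow A ᵥ* unitriangularInverse (minor A)) j
unitriangularInverse {suc k} A (F.suc i) F.zero    = 0ℤ
unitriangularInverse {suc k} A (F.suc i) (F.suc j) = unitriangularInverse (minor A) i j

unitriangularInverse-inverseʳ : ∀ {k} {A : Matrix k k} → IsUpperUnitriangular A →
                                ∀ i j → mul A (unitriangularInverse A) i j ≡ idMat i j
unitriangularInverse-inverseʳ {suc k} {A} ut = go
  where
  open IsUpperUnitriangular ut
  a = topRow A
  B' = unitriangularInverse (minor A)
  lowerRows = unitriangularInverse A ∘ F.suc
  first-column-zero = unitriangular-first-column ut
  go : ∀ i j → mul A (unitriangularInverse A) i j ≡ idMat i j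
  go F.zero F.zero = cong₂ _+_ (trans (ℤ.*-identityʳ _) (diagonal F.zero))
                               (ᵥ*-zero-column a lowerRows F.zero (λ _ → refl))
  go F.zero (F.suc j) = begin
    A F.zero F.zero * - (a ᵥ* B') j + (a ᵥ* B') j
      ≡⟨ cong (λ z → z * - (a ᵥ* B') j + (a ᵥ* B') j) (diagonal F.zero) ⟩
    1ℤ * - (a ᵥ* B') j + (a ᵥ* B') j
      ≡⟨ cong (_+ (a ᵥ* B') j) (ℤ.*-identityˡ (- (a ᵥ* B') j)) ⟩
    - (a ᵥ* B') j + (a ᵥ* B') j
      ≡⟨ ℤ.+-inverseˡ ((a ᵥ* B') j) ⟩
    0ℤ ∎
  go (F.suc i) F.zero = begin
    A (F.suc i) F.zero * 1ℤ + (minor A i ᵥ* lowerRows) F.zero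
      ≡⟨ cong₂ _+_ (ℤ.*-identityʳ (A (F.suc i) F.zero))
                   (ᵥ*-zero-column (minor A i) lowerRows F.zero (λ _ → refl)) ⟩
    A (F.suc i) F.zero + 0ℤ
      ≡⟨ trans (ℤ.+-identityʳ (A (F.suc i) F.zero)) (first-column-zero i) ⟩
    0ℤ ∎
  go (F.suc i) (F.suc j) = begin
    A (F.suc i) F.zero * - (a ᵥ* B') j + mul (minor A) B' i j
      ≡⟨ cong (λ z → z * - (a ᵥ* B') j + mul (minor A) B' i j) (first-column-zero i) ⟩
    0ℤ + mul (minor A) B' i j
      ≡⟨ ℤ.+-identityˡ _ ⟩
    mul (minor A) B' i j
      ≡⟨ unitriangularInverse-inverseʳ (minor-unitriangular ut) i j ⟩
    idMat i j ∎

unitriangularInverse-inverseˡ : ∀ {k} {A : Matrix k k} → IsUpperUnitriangular A →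
                                ∀ i j → mul (unitriangularInverse A) A i j ≡ idMat i j
unitriangularInverse-inverseˡ {suc k} {A} ut = go
  where
  open IsUpperUnitriangular ut
  a = topRow A
  B' = unitriangularInverse (minor A)
  s = a ᵥ* B'
  first-column-zero = unitriangular-first-column ut
  go : ∀ i j → mul (unitriangularInverse A) A i j ≡ idMat i j
  go F.zero F.zero = cong₂ _+_ (trans (ℤ.*-identityˡ _) (diagonal F.zero))
                               (ᵥ*-zero-column (λ m → - s m) (A ∘ F.suc) F.zero first-column-zero)
  go F.zero (F.suc j) = begin
    1ℤ * a j + ((λ m → - s m) ᵥ* minor A) j
      ≡⟨ cong₂ _+_ (ℤ.*-identityˡ (a j)) (ᵥ*-negˡ s (minor A) j) ⟩
    a j - (s ᵥ* minor A) j
      ≡⟨ cong (λ z → a j - z) (ᵥ*-assoc a B' (minor A) j) ⟩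
    a j - (a ᵥ* mul B' (minor A)) j
      ≡⟨ cong (λ z → a j - z) (sum-cong-≗ λ r →
           cong (a r *_) (unitriangularInverse-inverseˡ (minor-unitriangular ut) r j)) ⟩
    a j - (a ᵥ* idMat) j
      ≡⟨ cong (λ z → a j - z) (ᵥ*-identityʳ a j) ⟩
    a j - a j
      ≡⟨ ℤ.+-inverseʳ (a j) ⟩
    0ℤ ∎
  go (F.suc i) F.zero =
    cong₂ _+_ (ℤ.*-zeroˡ (A F.zero F.zero)) (ᵥ*-zero-column (B' i) (A ∘ F.suc) F.zero first-column-zero)
  go (F.suc i) (F.suc j) = begin
    0ℤ * a j + mul B' (minor A) i j ≡⟨ cong (_+ mul B' (minor A) i j) (ℤ.*-zeroˡ (a j)) ⟩
    0ℤ + mul B' (minor A) i j       ≡⟨ ℤ.+-identityˡ _ ⟩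
    mul B' (minor A) i j            ≡⟨ unitriangularInverse-inverseˡ (minor-unitriangular ut) i j ⟩
    idMat i j                       ∎

unitriangular⇒InGL : ∀ {k} {A : Matrix k k} → IsUpperUnitriangular A → InGL A
unitriangular⇒InGL ut =
  unitriangularInverse _ , unitriangularInverse-inverseʳ ut , unitriangularInverse-inverseˡ ut

-- Polynomials are coefficient sequences ℕ → ℤ; mulByRoot a p is (X − a)·p and
-- newton c k is ∏_{m<k} (X − c m).
evalPoly : ℕ → (ℕ → ℤ) → ℤ → ℤ
evalPoly N p x = sumFin {N} (λ r → x ^ toℕ r * p (toℕ r))

evalPoly-suc : ∀ N p x → evalPoly (suc N) p x ≡ evalPoly N p x + x ^ N * p N
evalPoly-suc N p x = begin
  evalPoly (suc N) p x
    ≡⟨ sum-init-last {N} (λ r → x ^ toℕ r * p (toℕ r)) ⟩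
  sumFin {N} (λ r → x ^ toℕ (inject₁ r) * p (toℕ (inject₁ r)))
    + x ^ toℕ (fromℕ N) * p (toℕ (fromℕ N))
    ≡⟨ cong₂ _+_ (sum-cong-≗ {N} λ r → cong (λ m → x ^ m * p m) (toℕ-inject₁ r))
                 (cong (λ m → x ^ m * p m) (toℕ-fromℕ N)) ⟩
  evalPoly N p x + x ^ N * p N ∎

mulByRoot : ℤ → (ℕ → ℤ) → (ℕ → ℤ)
mulByRoot a p zero    = - (a * p 0)
mulByRoot a p (suc r) = p r - a * p (suc r)

evalPoly-mulByRoot : ∀ N a p x → p N ≡ 0ℤ →
                     evalPoly (suc N) (mulByRoot a p) x ≡ (x - a) * evalPoly N p x
evalPoly-mulByRoot N a p x pN≡0 = begin
  evalPoly (suc N) (mulByRoot a p) x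
    ≡⟨⟩
  1ℤ * - (a * p 0) + sumFin {N} (λ r → x ^ suc (toℕ r) * (p (toℕ r) - a * p (suc (toℕ r))))
    ≡⟨ cong (1ℤ * - (a * p 0) +_) (sum-cong-≗ {N} λ r →
         solve 5 (λ x y u v a → (x :* y) :* (u :- a :* v) := x :* (y :* u) :- a :* ((x :* y) :* v))
               refl x (x ^ toℕ r) (p (toℕ r)) (p (suc (toℕ r))) a) ⟩
  1ℤ * - (a * p 0) + sumFin (λ r → x * monomial r - a * shiftedMonomial r)
    ≡⟨ cong (1ℤ * - (a * p 0) +_)
         (trans (sum-distrib-- (λ r → x * monomial r) (λ r → a * shiftedMonomial r))
                (cong₂ _-_ (sym (*-distribˡ-sum x monomial)) (sym (*-distribˡ-sum a shiftedMonomial)))) ⟩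
  1ℤ * - (a * p 0) + (x * E - a * S)
    ≡⟨ solve 5 (λ p₀ a x E S → con 1ℤ :* (:- (a :* p₀)) :+ (x :* E :- a :* S)
                               := x :* E :- a :* (con 1ℤ :* p₀ :+ S)) refl (p 0) a x E S ⟩
  x * E - a * evalPoly (suc N) p x
    ≡⟨ cong (λ z → x * E - a * z) (evalPoly-suc N p x) ⟩
  x * E - a * (E + x ^ N * p N)
    ≡⟨ cong (λ z → x * E - a * (E + z)) (trans (cong (x ^ N *_) pN≡0) (ℤ.*-zeroʳ (x ^ N))) ⟩
  x * E - a * (E + 0ℤ)
    ≡⟨ solve 3 (λ x a E → x :* E :- a :* (E :+ con 0ℤ) := (x :- a) :* E) refl x a E ⟩
  (x - a) * E ∎
  where
  E = evalPoly N p x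
  monomial shiftedMonomial : Fin N → ℤ
  monomial r = x ^ toℕ r * p (toℕ r)
  shiftedMonomial r = x ^ suc (toℕ r) * p (suc (toℕ r))
  S = sumFin shiftedMonomial

rootProduct : (ℕ → ℤ) → ℕ → ℤ → ℤ
rootProduct c zero    x = 1ℤ
rootProduct c (suc k) x = (x - c 0) * rootProduct (c ∘ suc) k x

newton : (ℕ → ℤ) → ℕ → (ℕ → ℤ)
newton c zero    zero    = 1ℤ
newton c zero    (suc r) = 0ℤ
newton c (suc k) r       = mulByRoot (c 0) (newton (c ∘ suc) k) r

newton-degree : ∀ c k r → k < r → newton c k r ≡ 0ℤ
newton-degree c zero    (suc r) _         = refl
newton-degree c (suc k) (suc r) (s≤s k<r) = begin
  newton (c ∘ suc) k r - c 0 * newton (c ∘ suc) k (suc r)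
    ≡⟨ cong₂ (λ u v → u - c 0 * v) (newton-degree (c ∘ suc) k r k<r)
                                   (newton-degree (c ∘ suc) k (suc r) (m<n⇒m<1+n k<r)) ⟩
  0ℤ - c 0 * 0ℤ
    ≡⟨ cong (λ z → 0ℤ - z) (ℤ.*-zeroʳ (c 0)) ⟩
  0ℤ ∎

newton-monic : ∀ c k → newton c k k ≡ 1ℤ
newton-monic c zero    = refl
newton-monic c (suc k) = begin
  newton (c ∘ suc) k k - c 0 * newton (c ∘ suc) k (suc k)
    ≡⟨ cong₂ (λ u v → u - c 0 * v) (newton-monic (c ∘ suc) k)
                                   (newton-degree (c ∘ suc) k (suc k) (n<1+n k)) ⟩
  1ℤ - c 0 * 0ℤ
    ≡⟨ cong (λ z → 1ℤ - z) (ℤ.*-zeroʳ (c 0)) ⟩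
  1ℤ ∎

evalPoly-newton : ∀ N c k x → k < N → evalPoly N (newton c k) x ≡ rootProduct c k x
evalPoly-newton (suc N) c zero    x _ =
  cong (1ℤ +_) (sum-zero {N} λ r → ℤ.*-zeroʳ (x ^ suc (toℕ r)))
evalPoly-newton (suc N) c (suc k) x (s≤s k<N) = begin
  evalPoly (suc N) (mulByRoot (c 0) (newton (c ∘ suc) k)) x
    ≡⟨ evalPoly-mulByRoot N (c 0) (newton (c ∘ suc) k) x (newton-degree (c ∘ suc) k N k<N) ⟩
  (x - c 0) * evalPoly N (newton (c ∘ suc) k) x
    ≡⟨ cong ((x - c 0) *_) (evalPoly-newton N (c ∘ suc) k x k<N) ⟩
  (x - c 0) * rootProduct (c ∘ suc) k x ∎

newtonMatrix : ∀ {k} → (ℕ → ℤ) → Matrix k k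
newtonMatrix c r k = newton c (toℕ k) (toℕ r)

newtonMatrix-unitriangular : ∀ {k} (c : ℕ → ℤ) → IsUpperUnitriangular (newtonMatrix {k} c)
newtonMatrix-unitriangular c = record
  { below-diagonal = λ r k k<r → newton-degree c (toℕ k) (toℕ r) k<r
  ; diagonal       = λ k → newton-monic c (toℕ k)
  }

vandermonde-newtonMatrix : ∀ {n} d (τ : Fin n → ℤ) c i k →
                           mul (vandermonde d τ) (newtonMatrix c) i k ≡ rootProduct c (toℕ k) (τ i)
vandermonde-newtonMatrix d τ c i k = evalPoly-newton (suc d) c (toℕ k) (τ i) (toℕ<n k)

-- Padding by 0 is harmless: only the first k ≤ n values enter rootProduct.
extendByZero : ∀ {n} → (Fin n → ℤ) → (ℕ → ℤ)
extendByZero {zero}  σ r       = 0ℤ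
extendByZero {suc n} σ zero    = σ F.zero
extendByZero {suc n} σ (suc r) = extendByZero (σ ∘ F.suc) r

prodFin-rootProduct : ∀ {n} (σ : Fin n → ℤ) x k → k ≤ n →
  prodFin (λ m → if does (toℕ m <? k) then x - σ m else 1ℤ) ≡ rootProduct (extendByZero σ) k x
prodFin-rootProduct {n} σ x zero    _         = prod-one {n} (λ _ → refl)
prodFin-rootProduct     σ x (suc k) (s≤s k≤n) =
  cong ((x - σ F.zero) *_) (prodFin-rootProduct (σ ∘ F.suc) x k k≤n)

lemma1p2 : (d n : ℕ) → 1 ≤ d → suc d ≤ n → (τ : Fin n → ℤ)
    → (∀ i j → i F.< j → τ i Z.< τ j)
    → Σ (Matrix (suc d) (suc d)) (λ U →
        InGL U × (∀ i k → mul (vandermonde d τ) U i k ≡ Wmat d τ i k))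
lemma1p2 d n _ d<n τ _ =
  newtonMatrix c , unitriangular⇒InGL (newtonMatrix-unitriangular c) , VU≡W
  where
  c = extendByZero τ
  VU≡W : ∀ i k → mul (vandermonde d τ) (newtonMatrix c) i k ≡ Wmat d τ i k
  VU≡W i k = trans (vandermonde-newtonMatrix d τ c i k)
                   (sym (prodFin-rootProduct τ (τ i) (toℕ k) (<⇒≤ (≤-trans (toℕ<n k) d<n))))
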